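{- Let $r\geq 2$ be even and $p$ an odd prime. Then $D_{S(p^r)^*}\leq 5$.
   Context: For a natural number $m$, $\mathbb Z_m=\mathbb Z/m\mathbb Z$ and $S(m)^*=\{x^2:x\in\mathbb Z_m\}\setminus\{0\}$. For $A\subseteq\mathbb Z_m$, a subsequence $T$ of a sequence $(x_1,\dots,x_k)$ in $\mathbb Z_m$, with nonempty index set $I$, is an $A$-weighted zero-sum subsequence if there exist $a_i\in A$ ($i\in I$) with $\sum_{i\in I}a_ix_i=0$. $D_{S(m)^*}$ is the least positive integer $k$ such that every sequence of length $k$ in $\mathbb Z_m$ has an $S(m)^*$-weighted zero-sum subsequence. -}

module Defs where

open import Data.Nat using (ℕ; zero; suc; _+_; _*_; NonZero; _≤_)
open import Data.Nat.DivMod using (_%_)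
open import Data.Fin using (Fin; toℕ)
open import Data.Bool using (Bool; true; false)
open import Data.Product using (Σ; ∃; ∃-syntax; _×_)
open import Relation.Binary.PropositionalEquality using (_≡_; _≢_)

-- Elements of ℤ_m are represented by their canonical residues, i.e. by Fin m.

sumOver : (k : ℕ) → (Fin k → Bool) → (Fin k → ℕ) → ℕ
sumOver zero    I f = 0
sumOver (suc k) I f with I Fin.zero
... | true  = f Fin.zero + sumOver k (λ i → I (Fin.suc i)) (λ i → f (Fin.suc i))
... | false = sumOver k (λ i → I (Fin.suc i)) (λ i → f (Fin.suc i))

InSstar : (m : ℕ) .{{_ : NonZero m}} → Fin m → Set
InSstar m a = (toℕ a ≢ 0) × (Σ (Fin m) λ y → ((toℕ y * toℕ y) % m ≡ toℕ a))

HasSstarZeroSum : (m : ℕ) .{{_ : NonZero m}} → (k : ℕ) → (Fin k → Fin m) → Set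
HasSstarZeroSum m k x =
  Σ (Fin k → Bool) λ I →
  Σ (Fin k → Fin m) λ a →
    (∃[ i ] (I i ≡ true))
  × (∀ i → I i ≡ true → InSstar m (a i))
  × (sumOver k I (λ i → toℕ (a i) * toℕ (x i)) % m ≡ 0)

AllSeqsHaveZeroSum : (m : ℕ) .{{_ : NonZero m}} → ℕ → Set
AllSeqsHaveZeroSum m k = (x : Fin k → Fin m) → HasSstarZeroSum m k x

-- D_{S(m)^*} ≤ n : the least positive k with the property is ≤ n, i.e. some
-- positive k ≤ n has the property.
DSstar≤ : (m : ℕ) .{{_ : NonZero m}} → ℕ → Set
DSstar≤ m n = ∃[ k ] ((1 ≤ k) × (k ≤ n) × AllSeqsHaveZeroSum m k)

module Submission where

open import Defs
open import Data.Nat using (ℕ; _^_; _≤_)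
open import Data.Nat.Properties using (m^n≢0)
open import Data.Nat.Divisibility using (_∣_)
open import Data.Nat.Primality using (Prime; prime⇒nonZero)
open import Relation.Binary.PropositionalEquality using (_≢_)

open import Data.Bool using (Bool; true; false; not; if_then_else_)
open import Data.Bool.Properties using () renaming (_≟_ to _≟ᵇ_)
open import Data.Fin as Fin using (Fin; zero; suc; toℕ; fromℕ<; splitAt; join; punchIn)
open import Data.Fin.Properties as Finₚ
  using (all?; any?; pigeonhole; toℕ-injective; fromℕ<-injective; toℕ-fromℕ<; toℕ<n; join-splitAt)
open import Data.List using ([]; _∷_)
open import Data.Nat
open import Data.Nat.Coprimality using (Coprime; coprime-Bézout)
open import Data.Nat.Divisibility
open import Data.Nat.DivMod
open import Data.Nat.GCD using (module Bézout)
open import Data.Nat.Primality using (¬prime[0]; ¬prime[1]; prime⇒irreducible; euclidsLemma)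
open import Data.Nat.Properties
open import Data.Nat.Tactic.RingSolver using (solve)
open import Data.Product using (∃₂; ∃-syntax; _,_; _×_; map₂)
open import Data.Sum using (_⊎_; inj₁; inj₂; [_,_]′)
open import Data.Vec as Vec using (Vec; lookup; tabulate)
open import Data.Vec.Properties using (lookup∘tabulate)
open import Data.Vec.Functional using (Vector; removeAt; insertAt)
open import Data.Vec.Functional.Properties using (insertAt-lookup; insertAt-punchIn)
open import Algebra.Properties.Semiring.Sum +-*-semiring using (sum; sum-remove; sum-cong-≗; *-distribˡ-sum)
open import Function using (_∘_)
open import Relation.Binary.Definitions using (tri<; tri≈; tri>)
open import Relation.Binary.PropositionalEquality
open import Relation.Nullary using (¬_; Dec; yes; no; does; proof; contradiction)
open import Relation.Nullary.Decidable using (map′; _×-dec_; from-yes; dec-false)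
open import Relation.Nullary.Reflects using (Reflects; invert)
open import Relation.Unary using (Decidable)
open ≡-Reasoning

-- Write p = 2h + 1 and p^r = q²p² with q = p^(r/2 - 1).  It suffices to find c₁, …, c₅, not all
-- divisible by p, with p² ∣ Σ cᵢ² xᵢ: the weights (q cᵢ)² with p ∤ cᵢ are nonzero squares modulo
-- p^r, and the terms with p ∣ cᵢ vanish modulo p^r anyway.  Three of the five xᵢ are all units or
-- all multiples of p.  For three units x, y, z, the h + 1 residues z + u²x and the h + 1 residues
-- −w²y (0 ≤ u, w ≤ h) cannot all be distinct, so p ∣ u²x + w²y + z, and a Hensel step replaces the
-- weight 1 of z by some 1 + tp to reach p².  Three multiples of p are divided by p and treated by
-- the same two-squares argument, unless one of them is already divisible by p².

%-cong-+ : ∀ {a b c d} n .{{_ : NonZero n}} → a % n ≡ b % n → c % n ≡ d % n → (a + c) % n ≡ (b + d) % n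
%-cong-+ {a} {b} {c} {d} n a≡b c≡d = begin
  (a + c) % n           ≡⟨ %-distribˡ-+ a c n ⟩
  (a % n + c % n) % n   ≡⟨ cong₂ (λ u v → (u + v) % n) a≡b c≡d ⟩
  (b % n + d % n) % n   ≡⟨ %-distribˡ-+ b d n ⟨
  (b + d) % n           ∎

[m%n*o]%n≡[m*o]%n : ∀ m o n .{{_ : NonZero n}} → (m % n * o) % n ≡ (m * o) % n
[m%n*o]%n≡[m*o]%n m o n = begin
  (m % n * o) % n             ≡⟨ %-distribˡ-* (m % n) o n ⟩
  (m % n % n * (o % n)) % n   ≡⟨ cong (λ u → (u * (o % n)) % n) (m%n%n≡m%n m n) ⟩
  (m % n * (o % n)) % n       ≡⟨ %-distribˡ-* m o n ⟨
  (m * o) % n                 ∎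

[m+n]%o≡m%o⇒o∣n : ∀ m n o .{{_ : NonZero o}} → (m + n) % o ≡ m % o → o ∣ n
[m+n]%o≡m%o⇒o∣n m n o eq = divides ((r + n) / o) (+-cancelˡ-≡ r n _ (begin
  r + n                          ≡⟨ m≡m%n+[m/n]*n (r + n) o ⟩
  (r + n) % o + (r + n) / o * o  ≡⟨ cong (_+ (r + n) / o * o) (trans r+n≡m+n eq) ⟩
  r + (r + n) / o * o            ∎))
  where
  r : ℕ
  r = m % o
  r+n≡m+n : (r + n) % o ≡ (m + n) % o
  r+n≡m+n = %-cong-+ o (m%n%n≡m%n m o) refl

sum-cong-% : ∀ {k} n .{{_ : NonZero n}} (f g : Vector ℕ k) → (∀ i → f i % n ≡ g i % n) → sum f % n ≡ sum g % n
sum-cong-% {zero}  n f g f≡g = refl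
sum-cong-% {suc k} n f g f≡g = %-cong-+ n (f≡g zero) (sum-cong-% n (f ∘ suc) (g ∘ suc) (f≡g ∘ suc))

sumOver≡sum : ∀ k (I : Fin k → Bool) (f : Fin k → ℕ) → sumOver k I f ≡ sum (λ i → if I i then f i else 0)
sumOver≡sum zero    I f = refl
sumOver≡sum (suc k) I f with I zero
... | true  = cong (f zero +_) (sumOver≡sum k (I ∘ suc) (f ∘ suc))
... | false = sumOver≡sum k (I ∘ suc) (f ∘ suc)

prime∤⇒coprime : ∀ {p a} → Prime p → ¬ p ∣ a → Coprime p a
prime∤⇒coprime p-prime p∤a (d∣p , d∣a) with prime⇒irreducible p-prime d∣p
... | inj₁ d≡1  = d≡1
... | inj₂ refl = contradiction d∣a p∤a

prime∤* : ∀ {p a b} → Prime p → ¬ p ∣ a → ¬ p ∣ b → ¬ p ∣ a * b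
prime∤* p-prime p∤a p∤b p∣ab = [ p∤a , p∤b ]′ (euclidsLemma _ _ p-prime p∣ab)

linear-congruence-solvable : ∀ {p a} → Prime p → ¬ p ∣ a → ∀ k → ∃[ t ] p ∣ k + a * t
linear-congruence-solvable {zero} p-prime = contradiction p-prime ¬prime[0]
linear-congruence-solvable {p@(suc p′)} {a} p-prime p∤a k with coprime-Bézout (prime∤⇒coprime p-prime p∤a)
... | Bézout.+- x y 1+ya≡xp = k * y , divides (k * x) (begin
  k + a * (k * y)  ≡⟨ solve (k ∷ a ∷ y ∷ []) ⟩
  k * (1 + y * a)  ≡⟨ cong (k *_) 1+ya≡xp ⟩
  k * (x * p)      ≡⟨ *-assoc k x p ⟨
  k * x * p        ∎)
... | Bézout.-+ x y 1+xp≡ya = k * p′ * y , divides (k + k * p′ * x) (begin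
  k + a * (k * p′ * y)      ≡⟨ solve (k ∷ a ∷ p′ ∷ y ∷ []) ⟩
  k + k * p′ * (y * a)      ≡⟨ cong (λ v → k + k * p′ * v) 1+xp≡ya ⟨
  k + k * p′ * (1 + x * p)  ≡⟨ solve (k ∷ p′ ∷ x ∷ []) ⟩
  (k + k * p′ * x) * p      ∎)

splitAt-injective : ∀ m {n} {i j : Fin (m + n)} → splitAt m i ≡ splitAt m j → i ≡ j
splitAt-injective m {n} {i} {j} eq = begin
  i                      ≡⟨ join-splitAt m n i ⟨
  join m n (splitAt m i) ≡⟨ cong (join m n) eq ⟩
  join m n (splitAt m j) ≡⟨ join-splitAt m n j ⟩
  j                      ∎

vec₃ : ∀ {A : Set} → A → A → A → Vector A 3
vec₃ a b c zero             = a
vec₃ a b c (suc zero)       = b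
vec₃ a b c (suc (suc zero)) = c

∀-Vec? : ∀ {n} {P : Vec Bool n → Set} → (∀ v → Dec (P v)) → Dec (∀ v → P v)
∀-Vec? {zero}  P? = map′ (λ p → λ { Vec.[] → p }) (λ f → f Vec.[]) (P? Vec.[])
∀-Vec? {suc n} P? = map′ (λ (t , f) → λ { (true Vec.∷ v) → t v ; (false Vec.∷ v) → f v })
                         (λ f → (λ v → f (true Vec.∷ v)) , (λ v → f (false Vec.∷ v)))
                         (∀-Vec? (λ v → P? (true Vec.∷ v)) ×-dec ∀-Vec? (λ v → P? (false Vec.∷ v)))

Constant : ∀ {n} → Vector Bool (suc n) → Set
Constant b = ∀ k → b k ≡ b zero

-- A triple of positions is given by the two positions deleted around it.
Monochromatic : Vector Bool 5 → Set
Monochromatic b = ∃₂ λ i j → Constant (removeAt (removeAt b i) j)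

monochromatic? : ∀ b → Dec (Monochromatic b)
monochromatic? b = any? λ i → any? λ j → all? λ k → _ ≟ᵇ _

-- Checked by evaluation on all 32 vectors.
all-monochromatic : ∀ v → Monochromatic (lookup v)
all-monochromatic = from-yes (∀-Vec? (monochromatic? ∘ lookup))

Monochromatic-resp : ∀ {b c} → (∀ k → b k ≡ c k) → Monochromatic b → Monochromatic c
Monochromatic-resp b≗c (i , j , const) = i , j , λ k → trans (sym (b≗c _)) (trans (const k) (b≗c _))

monochromatic : ∀ b → Monochromatic b
monochromatic b = Monochromatic-resp (lookup∘tabulate b) (all-monochromatic (tabulate b))

constant-decision : ∀ {n} {A : Set} {P : A → Set} (P? : Decidable P) (t : Vector A (suc n)) →
                    Constant (does ∘ P? ∘ t) → (∀ k → P (t k)) ⊎ (∀ k → ¬ P (t k))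
constant-decision P? t const with P? (t zero)
... | yes _ = inj₁ λ k → invert (subst (Reflects _) (const k) (proof (P? (t k))))
... | no  _ = inj₂ λ k → invert (subst (Reflects _) (const k) (proof (P? (t k))))

monochromatic-triple : ∀ {A : Set} {P : A → Set} (P? : Decidable P) (x : Vector A 5) →
  ∃₂ λ i j → let t = removeAt (removeAt x i) j in (∀ k → P (t k)) ⊎ (∀ k → ¬ P (t k))
monochromatic-triple P? x = map₂ (map₂ (constant-decision P? _)) (monochromatic (does ∘ P? ∘ x))

module OddPrime {p h : ℕ} (p-prime : Prime p) (p≡1+2h : p ≡ suc (h + h)) where

  instance
    p-nonZero : NonZero p
    p-nonZero = prime⇒nonZero p-prime

  ≤2h⇒<p : ∀ {n} → n ≤ h + h → n < p
  ≤2h⇒<p n≤2h = subst (_ <_) (sym p≡1+2h) (s≤s n≤2h)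

  p∤1 : ¬ p ∣ 1
  p∤1 p∣1 = ¬prime[1] (subst Prime (∣1⇒≡1 p∣1) p-prime)

  p∤2h : ¬ p ∣ h + h
  p∤2h p∣2h = p∤1 (∣m+n∣m⇒∣n (subst (p ∣_) (trans p≡1+2h (+-comm 1 (h + h))) ∣-refl) p∣2h)

  p∤2 : ¬ p ∣ 2
  p∤2 p∣2 = p∤2h (subst (p ∣_) (cong (h +_) (+-identityʳ h)) (∣m⇒∣m*n h p∣2))

  p∤tp+1 : ∀ t → ¬ p ∣ t * p + 1
  p∤tp+1 t p∣tp+1 = p∤1 (∣m+n∣m⇒∣n p∣tp+1 (n∣m*n t))

  p∣c²⇒p∣c : ∀ {c} → p ∣ c * c → p ∣ c
  p∣c²⇒p∣c p∣c² = [ (λ d → d) , (λ d → d) ]′ (euclidsLemma _ _ p-prime p∣c²)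

  p∣⇒p²∣*p : ∀ {n m} → p ∣ n → n * p ≡ m → p * p ∣ m
  p∣⇒p²∣*p p∣n refl = *-monoˡ-∣ p p∣n

  square-residues-distinct : ∀ {A} K {u v} → ¬ p ∣ A → u < v → v ≤ h →
                             (K + u * u * A) % p ≢ (K + v * v * A) % p
  square-residues-distinct {A} K {u} p∤A u<v v≤h eq with m≤n⇒∃[o]m+o≡n u<v
  ... | e , refl = prime∤* p-prime (prime∤* p-prime p∤v-u p∤v+u) p∤A p∣v²A-u²A
    where
    -- Here v = suc u + e, and v² − u² = (v − u)(v + u) with both factors in (0, p).
    p∣v²A-u²A : p ∣ suc e * (suc u + e + u) * A
    p∣v²A-u²A = [m+n]%o≡m%o⇒o∣n (K + u * u * A) _ p (begin
      (K + u * u * A + suc e * (suc u + e + u) * A) % p  ≡⟨ cong (_% p) (solve (K ∷ u ∷ e ∷ A ∷ [])) ⟩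
      (K + (suc u + e) * (suc u + e) * A) % p            ≡⟨ eq ⟨
      (K + u * u * A) % p                                ∎)
    p∤v-u : ¬ p ∣ suc e
    p∤v-u = >⇒∤ (≤2h⇒<p (≤-trans (≤-trans (s≤s (m≤n+m e u)) v≤h) (m≤m+n h h)))
    p∤v+u : ¬ p ∣ suc u + e + u
    p∤v+u = >⇒∤ (≤2h⇒<p (+-mono-≤ v≤h (<⇒≤ (<-≤-trans u<v v≤h))))

  square-residues-injective : ∀ {A} K {u v} → ¬ p ∣ A → u ≤ h → v ≤ h →
                              (K + u * u * A) % p ≡ (K + v * v * A) % p → u ≡ v
  square-residues-injective K {u} {v} p∤A u≤h v≤h eq with <-cmp u v
  ... | tri< u<v _ _ = contradiction eq (square-residues-distinct K p∤A u<v v≤h)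
  ... | tri≈ _ u≡v _ = u≡v
  ... | tri> _ _ v<u = contradiction (sym eq) (square-residues-distinct K p∤A v<u u≤h)

  -- Pigeonhole on the h + 1 residues of z + u²x and the h + 1 residues of 2h·w²y ≡ −w²y.
  two-squares : ∀ {x y} z → ¬ p ∣ x → ¬ p ∣ y → ∃₂ λ u w → p ∣ u * u * x + w * w * y + z
  two-squares {x} {y} z p∤x p∤y = collision (pigeonhole p<2h+2 (residue ∘ value ∘ splitAt (suc h)))
    where
    value : Fin (suc h) ⊎ Fin (suc h) → ℕ
    value (inj₁ u) = z + toℕ u * toℕ u * x
    value (inj₂ w) = 0 + toℕ w * toℕ w * ((h + h) * y)

    residue : ℕ → Fin p
    residue n = fromℕ< (m%n<n n p)

    p<2h+2 : p < suc h + suc h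
    p<2h+2 = subst (_< suc h + suc h) (sym p≡1+2h) (s≤s (+-monoʳ-< h (n<1+n h)))

    toℕ≤h : (u : Fin (suc h)) → toℕ u ≤ h
    toℕ≤h u = s≤s⁻¹ (toℕ<n u)

    cross : ∀ u w → (z + u * u * x) % p ≡ (w * w * ((h + h) * y)) % p → p ∣ u * u * x + w * w * y + z
    cross u w eq = m%n≡0⇒n∣m _ p (begin
      (u * u * x + w * w * y + z) % p          ≡⟨ cong (_% p) (solve (u ∷ x ∷ w ∷ y ∷ z ∷ [])) ⟩
      (z + u * u * x + w * w * y) % p          ≡⟨ %-cong-+ p eq refl ⟩
      (w * w * ((h + h) * y) + w * w * y) % p  ≡⟨ cong (_% p) (solve (w ∷ h ∷ y ∷ [])) ⟩
      w * w * y * suc (h + h) % p              ≡⟨ cong (λ q → w * w * y * q % p) p≡1+2h ⟨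
      w * w * y * p % p                        ≡⟨ m*n%n≡0 (w * w * y) p ⟩
      0                                        ∎)

    collide : ∀ a b → a ≢ b → value a % p ≡ value b % p → ∃₂ λ u w → p ∣ u * u * x + w * w * y + z
    collide (inj₁ u) (inj₁ u′) u≢u′ eq = contradiction
      (cong inj₁ (toℕ-injective (square-residues-injective z p∤x (toℕ≤h u) (toℕ≤h u′) eq))) u≢u′
    collide (inj₂ w) (inj₂ w′) w≢w′ eq = contradiction
      (cong inj₂ (toℕ-injective (square-residues-injective 0 (prime∤* p-prime p∤2h p∤y) (toℕ≤h w) (toℕ≤h w′) eq))) w≢w′
    collide (inj₁ u) (inj₂ w) _ eq = toℕ u , toℕ w , cross (toℕ u) (toℕ w) eq
    collide (inj₂ w) (inj₁ u) _ eq = toℕ u , toℕ w , cross (toℕ u) (toℕ w) (sym eq)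

    collision : (∃₂ λ i j → i Fin.< j × residue (value (splitAt (suc h) i)) ≡ residue (value (splitAt (suc h) j))) →
                ∃₂ λ u w → p ∣ u * u * x + w * w * y + z
    collision (i , j , i<j , eq) = collide _ _ (Finₚ.<⇒≢ i<j ∘ splitAt-injective (suc h)) (fromℕ<-injective _ _ _ _ eq)

  hensel-lift : ∀ {S z} → ¬ p ∣ z → p ∣ S + z → ∃[ t ] p * p ∣ S + (t * p + 1) * (t * p + 1) * z
  hensel-lift {S} {z} p∤z (divides k S+z≡kp) with linear-congruence-solvable p-prime (prime∤* p-prime p∤2 p∤z) k
  ... | t , divides n k+2zt≡np = t , divides (n + t * t * z) (begin
    S + (t * p + 1) * (t * p + 1) * z               ≡⟨ solve (S ∷ t ∷ p ∷ z ∷ []) ⟩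
    (S + z) + 2 * z * t * p + t * t * z * (p * p)   ≡⟨ cong (λ s → s + 2 * z * t * p + t * t * z * (p * p)) S+z≡kp ⟩
    k * p + 2 * z * t * p + t * t * z * (p * p)     ≡⟨ solve (k ∷ z ∷ t ∷ p ∷ []) ⟩
    (k + 2 * z * t) * p + t * t * z * (p * p)       ≡⟨ cong (λ s → s * p + t * t * z * (p * p)) k+2zt≡np ⟩
    n * p * p + t * t * z * (p * p)                 ≡⟨ solve (n ∷ p ∷ t ∷ z ∷ []) ⟩
    (n + t * t * z) * (p * p)                       ∎)

  record SquareZeroSum {n} (x : Vector ℕ n) : Set where
    constructor squareZeroSum
    field
      weight      : Vector ℕ n
      unit-weight : ∃[ i ] ¬ p ∣ weight i
      p²∣sum      : p * p ∣ sum (λ i → weight i * weight i * x i)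

  SquareZeroSum-removeAt : ∀ {n} {x : Vector ℕ (suc n)} i → SquareZeroSum (removeAt x i) → SquareZeroSum x
  SquareZeroSum-removeAt {n} {x} i (squareZeroSum c (k , p∤cₖ) p²∣sum) =
    squareZeroSum c′ (punchIn i k , subst (¬_ ∘ (p ∣_)) (sym (insertAt-punchIn c i 0 k)) p∤cₖ)
                  (subst (p * p ∣_) (sym sum-c′) p²∣sum)
    where
    c′ : Vector ℕ (suc n)
    c′ = insertAt c i 0
    sum-c′ : sum (λ l → c′ l * c′ l * x l) ≡ sum (λ l → c l * c l * removeAt x i l)
    sum-c′ = begin
      sum (λ l → c′ l * c′ l * x l)
        ≡⟨ sum-remove {i = i} (λ l → c′ l * c′ l * x l) ⟩
      c′ i * c′ i * x i + sum (λ l → c′ (punchIn i l) * c′ (punchIn i l) * removeAt x i l)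
        ≡⟨ cong₂ (λ w s → w * w * x i + s) (insertAt-lookup c i 0)
                 (sum-cong-≗ λ l → cong (λ w → w * w * removeAt x i l) (insertAt-punchIn c i 0 l)) ⟩
      sum (λ l → c l * c l * removeAt x i l)
        ∎

  squareZeroSum₃ : ∀ {x y z} a b c → (∃[ k ] ¬ p ∣ vec₃ a b c k) →
                   p * p ∣ a * a * x + b * b * y + c * c * z → SquareZeroSum (vec₃ x y z)
  squareZeroSum₃ {x} {y} {z} a b c unit p²∣sum = squareZeroSum (vec₃ a b c) unit (subst (p * p ∣_) unfold p²∣sum)
    where
    unfold : a * a * x + b * b * y + c * c * z ≡ a * a * x + (b * b * y + (c * c * z + 0))
    unfold = solve (a ∷ b ∷ c ∷ x ∷ y ∷ z ∷ [])

  SquareZeroSum-η₃ : ∀ {t} → SquareZeroSum (vec₃ (t zero) (t (suc zero)) (t (suc (suc zero)))) → SquareZeroSum t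
  SquareZeroSum-η₃ (squareZeroSum c unit p²∣sum) = squareZeroSum c unit p²∣sum

  units⇒SquareZeroSum : ∀ {x y z} → ¬ p ∣ x → ¬ p ∣ y → ¬ p ∣ z → SquareZeroSum (vec₃ x y z)
  units⇒SquareZeroSum {z = z} p∤x p∤y p∤z =
    let u , w , p∣sum = two-squares z p∤x p∤y
        t , p²∣sum    = hensel-lift p∤z p∣sum
    in  squareZeroSum₃ u w (t * p + 1) (suc (suc zero) , p∤tp+1 t) p²∣sum

  multiples⇒SquareZeroSum : ∀ {x y z} → p ∣ x → p ∣ y → p ∣ z → SquareZeroSum (vec₃ x y z)
  multiples⇒SquareZeroSum (divides x′ refl) (divides y′ refl) (divides z′ refl) with p ∣? x′ | p ∣? y′
  ... | yes p∣x′ | _ =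
    squareZeroSum₃ 1 0 0 (zero , p∤1) (p∣⇒p²∣*p p∣x′ (solve (x′ ∷ y′ ∷ z′ ∷ p ∷ [])))
  ... | no _ | yes p∣y′ =
    squareZeroSum₃ 0 1 0 (suc zero , p∤1) (p∣⇒p²∣*p p∣y′ (solve (x′ ∷ y′ ∷ z′ ∷ p ∷ [])))
  ... | no p∤x′ | no p∤y′ = scale (two-squares z′ p∤x′ p∤y′)
    where
    scale : (∃₂ λ u w → p ∣ u * u * x′ + w * w * y′ + z′) → SquareZeroSum (vec₃ (x′ * p) (y′ * p) (z′ * p))
    scale (u , w , p∣sum) =
      squareZeroSum₃ u w 1 (suc (suc zero) , p∤1) (p∣⇒p²∣*p p∣sum (solve (u ∷ w ∷ x′ ∷ y′ ∷ z′ ∷ p ∷ [])))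

  squareZeroSum₅ : (x : Vector ℕ 5) → SquareZeroSum x
  squareZeroSum₅ x = from-triple (monochromatic-triple (p ∣?_) x)
    where
    from-triple : (∃₂ λ i j → let t = removeAt (removeAt x i) j in (∀ k → p ∣ t k) ⊎ (∀ k → ¬ p ∣ t k)) →
                  SquareZeroSum x
    from-triple (i , j , inj₁ p∣t) = SquareZeroSum-removeAt i (SquareZeroSum-removeAt j
      (SquareZeroSum-η₃ (multiples⇒SquareZeroSum (p∣t _) (p∣t _) (p∣t _))))
    from-triple (i , j , inj₂ p∤t) = SquareZeroSum-removeAt i (SquareZeroSum-removeAt j
      (SquareZeroSum-η₃ (units⇒SquareZeroSum (p∤t _) (p∤t _) (p∤t _))))

  module _ (m q : ℕ) .{{_ : NonZero m}} .{{_ : NonZero q}} (m≡q²p² : m ≡ q * q * (p * p)) where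

    residue : ℕ → Fin m
    residue n = fromℕ< (m%n<n n m)

    toℕ-residue : ∀ n → toℕ (residue n) ≡ n % m
    toℕ-residue n = toℕ-fromℕ< (m%n<n n m)

    m∣q²c²x : ∀ {c} x → p ∣ c → m ∣ q * q * (c * c * x)
    m∣q²c²x x (divides c′ refl) = divides (c′ * c′ * x) (begin
      q * q * (c′ * p * (c′ * p) * x)  ≡⟨ solve (q ∷ c′ ∷ p ∷ x ∷ []) ⟩
      c′ * c′ * x * (q * q * (p * p))  ≡⟨ cong (c′ * c′ * x *_) m≡q²p² ⟨
      c′ * c′ * x * m                  ∎)

    square∈Sstar : ∀ c → ¬ p ∣ c → InSstar m (residue (q * c * (q * c)))
    square∈Sstar c p∤c = nonzero , residue (q * c) , is-square
      where
      nonzero : toℕ (residue (q * c * (q * c))) ≢ 0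
      nonzero eq = p∤c (p∣c²⇒p∣c (∣-trans (m∣m*n p) (*-cancelˡ-∣ (q * q) {{m*n≢0 q q}} q²p²∣q²c²)))
        where
        q²p²∣q²c² : q * q * (p * p) ∣ q * q * (c * c)
        q²p²∣q²c² = subst₂ _∣_ m≡q²p² ([m*n]*[o*p]≡[m*o]*[n*p] q c q c)
                           (m%n≡0⇒n∣m _ m (trans (sym (toℕ-residue _)) eq))
      is-square : (toℕ (residue (q * c)) * toℕ (residue (q * c))) % m ≡ toℕ (residue (q * c * (q * c)))
      is-square = begin
        (toℕ (residue (q * c)) * toℕ (residue (q * c))) % m  ≡⟨ cong (λ r → (r * r) % m) (toℕ-residue (q * c)) ⟩
        ((q * c) % m * ((q * c) % m)) % m                    ≡⟨ %-distribˡ-* (q * c) (q * c) m ⟨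
        (q * c * (q * c)) % m                                ≡⟨ toℕ-residue _ ⟨
        toℕ (residue (q * c * (q * c)))                      ∎

    -- A term left out has p ∣ c, so it vanishes modulo m anyway.
    selected-term : ∀ c x → (if not (does (p ∣? c)) then toℕ (residue (q * c * (q * c))) * x else 0) % m ≡
                            q * q * (c * c * x) % m
    selected-term c x with p ∣? c
    ... | yes p∣c = trans (n∣m⇒m%n≡0 0 m (m ∣0)) (sym (n∣m⇒m%n≡0 _ m (m∣q²c²x x p∣c)))
    ... | no _    = begin
      toℕ (residue (q * c * (q * c))) * x % m  ≡⟨ cong (λ r → r * x % m) (toℕ-residue _) ⟩
      q * c * (q * c) % m * x % m              ≡⟨ [m%n*o]%n≡[m*o]%n (q * c * (q * c)) x m ⟩
      q * c * (q * c) * x % m                  ≡⟨ cong (λ n → n * x % m) ([m*n]*[o*p]≡[m*o]*[n*p] q c q c) ⟩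
      q * q * (c * c) * x % m                  ≡⟨ cong (_% m) (*-assoc (q * q) (c * c) x) ⟩
      q * q * (c * c * x) % m                  ∎

    allSeqsHaveZeroSum₅ : AllSeqsHaveZeroSum m 5
    allSeqsHaveZeroSum₅ x = from-weights (squareZeroSum₅ (toℕ ∘ x))
      where
      from-weights : SquareZeroSum (toℕ ∘ x) → HasSstarZeroSum m 5 x
      from-weights (squareZeroSum c (i₀ , p∤cᵢ₀) p²∣sum) = I , a , (i₀ , I[i₀]) , a∈Sstar , sum≡0
        where
        I : Fin 5 → Bool
        I i = not (does (p ∣? c i))

        a : Fin 5 → Fin m
        a i = residue (q * c i * (q * c i))

        I[i₀] : I i₀ ≡ true
        I[i₀] = cong not (dec-false (p ∣? c i₀) p∤cᵢ₀)

        a∈Sstar : ∀ i → I i ≡ true → InSstar m (a i)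
        a∈Sstar i I[i] with p ∣? c i
        a∈Sstar i ()   | yes _
        ...            | no p∤cᵢ = square∈Sstar (c i) p∤cᵢ

        sum≡0 : sumOver 5 I (λ i → toℕ (a i) * toℕ (x i)) % m ≡ 0
        sum≡0 = begin
          sumOver 5 I (λ i → toℕ (a i) * toℕ (x i)) % m              ≡⟨ cong (_% m) (sumOver≡sum 5 I _) ⟩
          sum (λ i → if I i then toℕ (a i) * toℕ (x i) else 0) % m   ≡⟨ sum-cong-% m _ _ (λ i → selected-term (c i) (toℕ (x i))) ⟩
          sum (λ i → q * q * (c i * c i * toℕ (x i))) % m             ≡⟨ cong (_% m) (*-distribˡ-sum (q * q) Σ-terms) ⟨
          q * q * sum Σ-terms % m                                     ≡⟨ n∣m⇒m%n≡0 _ m m∣q²Σ ⟩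
          0                                                           ∎
          where
          Σ-terms : Vector ℕ 5
          Σ-terms i = c i * c i * toℕ (x i)
          m∣q²Σ : m ∣ q * q * sum Σ-terms
          m∣q²Σ = subst (_∣ q * q * sum Σ-terms) (sym m≡q²p²) (*-monoʳ-∣ (q * q) p²∣sum)

    DSstar≤5 : DSstar≤ m 5
    DSstar≤5 = 5 , s≤s z≤n , ≤-refl , allSeqsHaveZeroSum₅

even-or-odd : ∀ n → ∃[ h ] (n ≡ h + h ⊎ n ≡ suc (h + h))
even-or-odd zero = 0 , inj₁ refl
even-or-odd (suc n) with even-or-odd n
... | h , inj₁ refl = h , inj₂ refl
... | h , inj₂ refl = suc h , inj₁ (cong suc (sym (+-suc h h)))

odd-prime : ∀ {p} → Prime p → p ≢ 2 → ∃[ h ] p ≡ suc (h + h)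
odd-prime {p} p-prime p≢2 with even-or-odd p
... | h , inj₂ p≡1+2h = h , p≡1+2h
... | h , inj₁ refl with prime⇒irreducible p-prime (divides h (solve (h ∷ [])))
...   | inj₁ ()
...   | inj₂ 2≡p = contradiction (sym 2≡p) p≢2

even-power : ∀ p k → p ^ (suc k * 2) ≡ p ^ k * p ^ k * (p * p)
even-power p k = begin
  p ^ (suc k * 2)          ≡⟨ ^-*-assoc p (suc k) 2 ⟨
  (p * p ^ k) ^ 2          ≡⟨ square-swap p (p ^ k) ⟩
  p ^ k * p ^ k * (p * p)  ∎
  where
  square-swap : ∀ a b → a * b * (a * b * 1) ≡ b * b * (a * a)
  square-swap a b = solve (a ∷ b ∷ [])

theorem9 : (p r : ℕ) → (pp : Prime p) → p ≢ 2 → 2 ≤ r → 2 ∣ r →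
    DSstar≤ (p ^ r) {{m^n≢0 p r {{prime⇒nonZero pp}}}} 5
theorem9 p r pp p≢2 2≤r (divides zero refl) = contradiction 2≤r λ ()
theorem9 p r pp p≢2 2≤r (divides (suc k) refl) =
  let h , p≡1+2h = odd-prime pp p≢2 in
  OddPrime.DSstar≤5 {h = h} pp p≡1+2h (p ^ r) (p ^ k) (even-power p k)
  where
  instance
    p≢0 : NonZero p
    p≢0 = prime⇒nonZero pp
    p^r≢0 : NonZero (p ^ r)
    p^r≢0 = m^n≢0 p r
    p^k≢0 : NonZero (p ^ k)
    p^k≢0 = m^n≢0 p k
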